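{- Let $G_B$ be a boundaried graph, $T_G\subseteq V(G)$, and $\ell\ge0$ such that $(G,T_G)$ has a Deletable Terminal Multiway Cut solution $S$ with $|S|\le\ell$. Let $F:=V(G)\setminus B$ and let $v\in F$ be such that there exist $\ell+|B|+2$ paths in $G$, each starting at $v$ and ending at a vertex of $T_G$, with pairwise distinct end vertices, and any two of which intersect only in $v$. Let $G':=G-v$ and $T'_G:=T_G\setminus\{v\}$. Then for every boundaried graph $H_B$ with $V(H)\cap V(G)=B$ and every $T_H\subseteq V(H)$, $\mathrm{OPT}(G_B\oplus H_B,T_G\cup T_H)=\mathrm{OPT}(G'_B\oplus H_B,T'_G\cup T_H)+1$, where $\mathrm{OPT}$ is the optimum of Deletable Terminal Multiway Cut.
   Context: All graphs are finite, simple, undirected. A boundaried graph $G_B$ is a graph $G$ with $B\subseteq V(G)$; for $V(G)\cap V(H)=B$, $G_B\oplus H_B$ has vertex set $V(G)\cup V(H)$ and edge set $E(G)\cup E(H)$. Deletable Terminal Multiway Cut: given a graph $G$ and $T\subseteq V(G)$, a feasible solution is any $Y\subseteq V(G)$ such that $G-Y$ has no path between two distinct vertices of $T\setminus Y$; value $|Y|$; $\mathrm{OPT}$ is the minimum value. -}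

module Defs where

open import Data.Nat using (ℕ; _≤_; _+_)
open import Data.Fin using (Fin)
open import Data.Fin.Subset public
  using (Subset; _∈_; _∉_; _⊆_; _∩_; _∪_; _─_; ⁅_⁆; ∣_∣)
open import Data.List using (List; []; _∷_)
import Data.List.Membership.Propositional as LM
open import Data.List.Relation.Unary.Unique.Propositional using (Unique)
open import Data.Product using (Σ; _×_; ∃; ∃-syntax)
open import Data.Sum using (_⊎_)
open import Relation.Nullary using (¬_)
open import Relation.Binary.PropositionalEquality using (_≡_; _≢_)

-- Graphs whose vertices are drawn from the ambient universe Fin n
-- (so that two graphs can share vertices, as needed for gluing).
record Graph (n : ℕ) : Set₁ where
  field
    V : Subset n
    E : Fin n → Fin n → Set
open Graph public

module _ {n : ℕ} where

  record Simple (G : Graph n) : Set where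
    field
      E-V     : ∀ {x y} → E G x y → x ∈ V G × y ∈ V G
      E-sym   : ∀ {x y} → E G x y → E G y x
      E-irrefl : ∀ {x} → ¬ E G x x

  _-_ : Graph n → Subset n → Graph n
  G - Y = record { V = V G ─ Y
                 ; E = λ x y → E G x y × x ∉ Y × y ∉ Y }

  _⊕_ : Graph n → Graph n → Graph n
  G ⊕ H = record { V = V G ∪ V H
                 ; E = λ x y → E G x y ⊎ E H x y }

  -- walks in a graph (a walk x..y exists iff a path x..y exists)
  data Walk (G : Graph n) : Fin n → Fin n → Set where
    [_] : ∀ {x} → x ∈ V G → Walk G x x
    _∷_ : ∀ {x y z} → E G x y → Walk G y z → Walk G x z

  verts : ∀ {G x y} → Walk G x y → List (Fin n)
  verts {x = x} [ _ ] = x ∷ []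
  verts {x = x} (_ ∷ w) = x ∷ verts w

  IsPath : ∀ {G x y} → Walk G x y → Set
  IsPath w = Unique (verts w)

  Feasible : Graph n → Subset n → Subset n → Set
  Feasible G T Y =
    Y ⊆ V G ×
    (∀ s t → s ∈ T → t ∈ T → s ∉ Y → t ∉ Y → s ≢ t → ¬ Walk (G - Y) s t)

  IsOPT : Graph n → Subset n → ℕ → Set
  IsOPT G T k =
    (∃[ Y ] (Feasible G T Y × ∣ Y ∣ ≡ k)) ×
    (∀ Y → Feasible G T Y → k ≤ ∣ Y ∣)

  FanPaths : Graph n → Subset n → Fin n → ℕ → Set
  FanPaths G T v m =
    Σ (Fin m → Fin n) λ ends →
    Σ ((i : Fin m) → Walk G v (ends i)) λ ps →
      (∀ i → IsPath (ps i)) ×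
      (∀ i → ends i ∈ T) ×
      (∀ i j → ends i ≡ ends j → i ≡ j) ×
      (∀ i j → i ≢ j → ∀ x →
         x LM.∈ verts (ps i) → x LM.∈ verts (ps j) → x ≡ v)

-- If v is not in an optimal solution Y of the glued instance, then the fan at v forces Y to
-- contain at least ℓ + |B| + 1 vertices of G: two fan paths missing Y would join two distinct
-- terminals, and distinct paths meet Y in distinct vertices since they share only v. Replacing
-- Y ∩ V(G) by B ∪ S, which is still a solution because B separates G from the rest, is then
-- strictly cheaper. So v lies in every optimal solution, whose remainder solves the reduced
-- instance; conversely, a solution of the reduced instance together with v solves the original.
module Submission where

open import Defs
open import Data.Nat using (ℕ; zero; suc; _≤_; _<_; _+_; z≤n; s≤s; s≤s⁻¹)
open import Data.Nat.Properties
  using (≤-trans; ≤-antisym; +-suc; +-comm; +-monoʳ-≤; +-monoʳ-<; <⇒≱; m≤n⇒m≤1+n; module ≤-Reasoning)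
open import Data.Fin as Fin using (Fin; punchIn)
open import Data.Fin.Properties using (all?; ¬∀⟶∃¬; punchIn-injective; punchInᵢ≢i; 0≢1+n)
  renaming (_≟_ to _≟ᶠ_; suc-injective to suc-injectiveᶠ)
open import Data.Fin.Subset using (outside; inside)
open import Data.Fin.Subset.Properties
  using (_∈?_; ∣p∣≤∣x∷p∣; ∣⁅x⁆∣≡1; x∈⁅y⁆⇒x≡y; x∉⁅y⁆⇒x≢y; x∈p∧x≢y⇒x∈p-y;
         x∈p⇒∣p-x∣<∣p∣; x∈p∩q⁺; x∈p∪q⁺; x∈p∪q⁻; x∈p∧x∉q⇒x∈p─q; p─q⊆p)
open import Data.Vec using ([]; _∷_; here; there)
open import Data.List.Relation.Unary.Any using (Any; any?)
open import Data.List.Relation.Unary.All using (All; []; _∷_)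
open import Data.List.Relation.Unary.All.Properties using (¬Any⇒All¬)
import Data.List.Membership.Propositional as List
open import Data.Product using (_×_; _,_; proj₁; proj₂; ∃-syntax)
open import Data.Sum using (inj₁; inj₂)
open import Data.Empty using (⊥-elim)
open import Data.Unit using (⊤; tt)
open import Function using (_∘_)
open import Function.Definitions using (Injective)
open import Relation.Nullary using (¬_; yes; no)
open import Relation.Nullary.Decidable using (decidable-stable)
open import Relation.Unary using (Decidable)
open import Relation.Binary.PropositionalEquality
  using (_≡_; _≢_; refl; sym; trans; cong; cong₂; subst)

∣p∪q∣≤∣p∣+∣q∣ : ∀ {m} (p q : Subset m) → ∣ p ∪ q ∣ ≤ ∣ p ∣ + ∣ q ∣
∣p∪q∣≤∣p∣+∣q∣ []            []            = z≤n
∣p∪q∣≤∣p∣+∣q∣ (inside  ∷ p) (x ∷ q)       =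
  s≤s (≤-trans (∣p∪q∣≤∣p∣+∣q∣ p q) (+-monoʳ-≤ ∣ p ∣ (∣p∣≤∣x∷p∣ x q)))
∣p∪q∣≤∣p∣+∣q∣ (outside ∷ p) (inside  ∷ q) =
  subst (suc ∣ p ∪ q ∣ ≤_) (sym (+-suc ∣ p ∣ ∣ q ∣)) (s≤s (∣p∪q∣≤∣p∣+∣q∣ p q))
∣p∪q∣≤∣p∣+∣q∣ (outside ∷ p) (outside ∷ q) = ∣p∪q∣≤∣p∣+∣q∣ p q

∣p─q∣+∣p∩q∣≡∣p∣ : ∀ {m} (p q : Subset m) → ∣ p ─ q ∣ + ∣ p ∩ q ∣ ≡ ∣ p ∣
∣p─q∣+∣p∩q∣≡∣p∣ []            []            = refl
∣p─q∣+∣p∩q∣≡∣p∣ (inside  ∷ p) (inside  ∷ q) =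
  trans (+-suc ∣ p ─ q ∣ ∣ p ∩ q ∣) (cong suc (∣p─q∣+∣p∩q∣≡∣p∣ p q))
∣p─q∣+∣p∩q∣≡∣p∣ (inside  ∷ p) (outside ∷ q) = cong suc (∣p─q∣+∣p∩q∣≡∣p∣ p q)
∣p─q∣+∣p∩q∣≡∣p∣ (outside ∷ p) (inside  ∷ q) = ∣p─q∣+∣p∩q∣≡∣p∣ p q
∣p─q∣+∣p∩q∣≡∣p∣ (outside ∷ p) (outside ∷ q) = ∣p─q∣+∣p∩q∣≡∣p∣ p q

x∈p─q⇒x∉q : ∀ {m} {x : Fin m} (p q : Subset m) → x ∈ p ─ q → x ∉ q
x∈p─q⇒x∉q (_ ∷ p) (outside ∷ q) here      ()
x∈p─q⇒x∉q (_ ∷ p) (_       ∷ q) (there x∈) (there x∈q) = x∈p─q⇒x∉q p q x∈ x∈q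

x∉p∪q⇒x∉p : ∀ {m} {x : Fin m} {p q : Subset m} → x ∉ p ∪ q → x ∉ p
x∉p∪q⇒x∉p x∉ x∈p = x∉ (x∈p∪q⁺ (inj₁ x∈p))

x∉p∪q⇒x∉q : ∀ {m} {x : Fin m} {p q : Subset m} → x ∉ p ∪ q → x ∉ q
x∉p∪q⇒x∉q x∉ x∈q = x∉ (x∈p∪q⁺ (inj₂ x∈q))

injective⇒≤∣p∣ : ∀ {m N} {p : Subset N} (f : Fin m → Fin N) →
  (∀ i → f i ∈ p) → Injective _≡_ _≡_ f → m ≤ ∣ p ∣
injective⇒≤∣p∣ {zero}  f f∈p f-inj = z≤n
injective⇒≤∣p∣ {suc m} f f∈p f-inj =
  ≤-trans (s≤s (injective⇒≤∣p∣ (f ∘ Fin.suc) f∘suc∈p-f₀ (suc-injectiveᶠ ∘ f-inj)))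
          (x∈p⇒∣p-x∣<∣p∣ (f∈p Fin.zero))
  where
  f∘suc∈p-f₀ : ∀ i → f (Fin.suc i) ∈ _ ─ ⁅ f Fin.zero ⁆
  f∘suc∈p-f₀ i = x∈p∧x≢y⇒x∈p-y (f∈p (Fin.suc i)) (0≢1+n ∘ sym ∘ f-inj)

almost-injective⇒≤suc∣p∣ : ∀ {m N} {p : Subset N} {P : Fin m → Set} → Decidable P →
  (∀ {i j} → ¬ P i → ¬ P j → i ≡ j) →
  (f : ∀ i → P i → Fin N) → (∀ i h → f i h ∈ p) →
  (∀ {i j} hᵢ hⱼ → f i hᵢ ≡ f j hⱼ → i ≡ j) → m ≤ suc ∣ p ∣
almost-injective⇒≤suc∣p∣ {zero} _ _ _ _ _ = z≤n
almost-injective⇒≤suc∣p∣ {suc m} {P = P} P? one-fails f f∈p f-inj with all? P?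
... | yes all-P =
  m≤n⇒m≤1+n (injective⇒≤∣p∣ (λ i → f i (all-P i)) (λ i → f∈p i _) (f-inj _ _))
... | no ¬all-P with ¬∀⟶∃¬ _ P P? ¬all-P
... | i₀ , ¬Pi₀ = s≤s (injective⇒≤∣p∣ g (λ j → f∈p _ _) (punchIn-injective i₀ _ _ ∘ f-inj _ _))
  where
  P-punchIn : ∀ j → P (punchIn i₀ j)
  P-punchIn j with P? (punchIn i₀ j)
  ... | yes h  = h
  ... | no  ¬h = ⊥-elim (punchInᵢ≢i i₀ j (one-fails ¬h ¬Pi₀))
  g : Fin m → Fin _
  g j = f (punchIn i₀ j) (P-punchIn j)

module _ {n : ℕ} where

  Separates : Graph n → Subset n → Subset n → Set
  Separates G T Y =
    ∀ s t → s ∈ T → t ∈ T → s ∉ Y → t ∉ Y → s ≢ t → ¬ Walk (G - Y) s t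

  mapWalk : {G G′ : Graph n} (P : Fin n → Set) →
    (∀ {x y} → E G x y → P x → P y × E G′ x y) →
    (∀ {x} → x ∈ V G → P x → x ∈ V G′) →
    ∀ {s t} → P s → Walk G s t → Walk G′ s t × P t
  mapWalk P edge vertex Ps [ s∈ ] = [ vertex s∈ Ps ] , Ps
  mapWalk P edge vertex Ps (e ∷ w) =
    let (Py , e′) = edge e Ps
        (w′ , Pt) = mapWalk P edge vertex Py w
    in (e′ ∷ w′) , Pt

  embedWalk : {G G′ : Graph n} → (∀ {x y} → E G x y → E G′ x y) → V G ⊆ V G′ →
    ∀ {s t} → Walk G s t → Walk G′ s t
  embedWalk edge vertex w =
    proj₁ (mapWalk (λ _ → ⊤) (λ e _ → tt , edge e) (λ x∈ _ → vertex x∈) tt w)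

  reverse-append : {K : Graph n} → (∀ {x y} → E K x y → E K y x) →
    ∀ {x y z} → Walk K x y → Walk K x z → Walk K y z
  reverse-append E-sym [ _ ]   acc = acc
  reverse-append E-sym (e ∷ w) acc = reverse-append E-sym w (E-sym e ∷ acc)

  verts⊆V : {G : Graph n} → Simple G → ∀ {x y} (w : Walk G x y) →
    ∀ {z} → z List.∈ verts w → z ∈ V G
  verts⊆V sG [ x∈ ]  (Any.here refl) = x∈
  verts⊆V sG (e ∷ w) (Any.here refl) = proj₁ (Simple.E-V sG e)
  verts⊆V sG (e ∷ w) (Any.there z∈)  = verts⊆V sG w z∈

  All-head : {G : Graph n} {P : Fin n → Set} → ∀ {x y} (w : Walk G x y) →
    All P (verts w) → P x
  All-head [ _ ]   (Px ∷ _) = Px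
  All-head (_ ∷ _) (Px ∷ _) = Px

  All-last : {G : Graph n} {P : Fin n → Set} → ∀ {x y} (w : Walk G x y) →
    All P (verts w) → P y
  All-last [ _ ]   (Px ∷ _)  = Px
  All-last (_ ∷ w) (_ ∷ Pw) = All-last w Pw

  avoidingWalk : {G : Graph n} {Y : Subset n} → ∀ {x y} (w : Walk G x y) →
    All (_∉ Y) (verts w) → Walk (G - Y) x y
  avoidingWalk [ x∈ ]  (x∉ ∷ []) = [ x∈p∧x∉q⇒x∈p─q x∈ x∉ ]
  avoidingWalk (e ∷ w) (x∉ ∷ w∉) = (e , x∉ , All-head w w∉) ∷ avoidingWalk w w∉

  walk-─-⊆ : {K : Graph n} {X Y : Subset n} → Y ⊆ X →
    ∀ {s t} → Walk (K - X) s t → Walk (K - Y) s t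
  walk-─-⊆ {K} {X} {Y} Y⊆X = embedWalk (λ (e , x∉ , y∉) → e , x∉ ∘ Y⊆X , y∉ ∘ Y⊆X) vertex
    where
    vertex : V K ─ X ⊆ V K ─ Y
    vertex x∈ = x∈p∧x∉q⇒x∈p─q (p─q⊆p _ X x∈) (x∈p─q⇒x∉q _ X x∈ ∘ Y⊆X)

  ∈-boundary : {G H : Graph n} {B : Subset n} → V H ∩ V G ≡ B →
    ∀ {x} → x ∈ V H → x ∈ V G → x ∈ B
  ∈-boundary H∩G≡B x∈H x∈G = subst (_ ∈_) H∩G≡B (x∈p∩q⁺ (x∈H , x∈G))

  separates-⊕ˡ : {G H : Graph n} {TG TH Y : Subset n} →
    Separates (G ⊕ H) (TG ∪ TH) Y → Separates G TG Y
  separates-⊕ˡ {G} {H} {Y = Y} sep s t s∈ t∈ s∉ t∉ s≢t w =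
    sep s t (x∈p∪q⁺ (inj₁ s∈)) (x∈p∪q⁺ (inj₁ t∈)) s∉ t∉ s≢t
      (embedWalk (λ (e , x∉ , y∉) → inj₁ e , x∉ , y∉) vertex w)
    where
    vertex : V G ─ Y ⊆ (V G ∪ V H) ─ Y
    vertex x∈ = x∈p∧x∉q⇒x∈p─q (x∈p∪q⁺ (inj₁ (p─q⊆p _ Y x∈))) (x∈p─q⇒x∉q _ Y x∈)

  fan-meets : {K : Graph n} {T Y : Subset n} {v : Fin n} {m : ℕ} → Simple K →
    Separates K T Y → v ∉ Y → FanPaths K T v m → m ≤ suc ∣ Y ∩ V K ∣
  fan-meets {K} {Y = Y} {m = m} sK sep v∉Y (ends , path , _ , ends∈T , ends-inj , disjoint) =
    almost-injective⇒≤suc∣p∣ (λ i → any? (_∈? Y) (verts (path i)))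
                             at-most-one-misses meet meet∈ meet-inj
    where
    Meets : Fin m → Set
    Meets i = Any (_∈ Y) (verts (path i))

    sym-K-Y : ∀ {x y} → E (K - Y) x y → E (K - Y) y x
    sym-K-Y (e , x∉ , y∉) = Simple.E-sym sK e , y∉ , x∉

    at-most-one-misses : ∀ {i j} → ¬ Meets i → ¬ Meets j → i ≡ j
    at-most-one-misses {i} {j} ¬i ¬j = decidable-stable (i ≟ᶠ j) λ i≢j →
      sep (ends i) (ends j) (ends∈T i) (ends∈T j)
          (All-last (path i) avoidᵢ) (All-last (path j) avoidⱼ) (i≢j ∘ ends-inj i j)
          (reverse-append sym-K-Y (avoidingWalk (path i) avoidᵢ)
                                  (avoidingWalk (path j) avoidⱼ))
      where
      avoidᵢ : All (_∉ Y) (verts (path i))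
      avoidᵢ = ¬Any⇒All¬ _ ¬i
      avoidⱼ : All (_∉ Y) (verts (path j))
      avoidⱼ = ¬Any⇒All¬ _ ¬j

    meet : ∀ i → Meets i → Fin n
    meet i h = proj₁ (List.find h)

    meet-on-path : ∀ i h → meet i h List.∈ verts (path i)
    meet-on-path i h = proj₁ (proj₂ (List.find h))

    meet∈Y : ∀ i h → meet i h ∈ Y
    meet∈Y i h = proj₂ (proj₂ (List.find h))

    meet∈ : ∀ i h → meet i h ∈ Y ∩ V K
    meet∈ i h = x∈p∩q⁺ (meet∈Y i h , verts⊆V sK (path i) (meet-on-path i h))

    meet-inj : ∀ {i j} hᵢ hⱼ → meet i hᵢ ≡ meet j hⱼ → i ≡ j
    meet-inj {i} {j} hᵢ hⱼ eq = decidable-stable (i ≟ᶠ j) λ i≢j →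
      v∉Y (subst (_∈ Y)
        (disjoint i j i≢j _ (meet-on-path i hᵢ)
                            (subst (List._∈ verts (path j)) (sym eq) (meet-on-path j hⱼ)))
        (meet∈Y i hᵢ))

  module _ {G H : Graph n} {TG TH : Subset n} {v : Fin n} where

    feasible-∪⁅v⁆ : v ∈ V G → ∀ {Y} →
      Feasible ((G - ⁅ v ⁆) ⊕ H) ((TG ─ ⁅ v ⁆) ∪ TH) Y →
      Feasible (G ⊕ H) (TG ∪ TH) (Y ∪ ⁅ v ⁆)
    feasible-∪⁅v⁆ v∈G {Y} (Y⊆ , sep) = ⊆V , sep′
      where
      ⊆V : Y ∪ ⁅ v ⁆ ⊆ V G ∪ V H
      ⊆V x∈ with x∈p∪q⁻ Y ⁅ v ⁆ x∈
      ... | inj₂ x∈⁅v⁆ = x∈p∪q⁺ (inj₁ (subst (_∈ V G) (sym (x∈⁅y⁆⇒x≡y v x∈⁅v⁆)) v∈G))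
      ... | inj₁ x∈Y with x∈p∪q⁻ (V G ─ ⁅ v ⁆) (V H) (Y⊆ x∈Y)
      ...   | inj₁ x∈G-v = x∈p∪q⁺ (inj₁ (p─q⊆p (V G) ⁅ v ⁆ x∈G-v))
      ...   | inj₂ x∈H   = x∈p∪q⁺ (inj₂ x∈H)

      terminal : ∀ {s} → s ∈ TG ∪ TH → s ∉ Y ∪ ⁅ v ⁆ → s ∈ (TG ─ ⁅ v ⁆) ∪ TH
      terminal s∈ s∉ with x∈p∪q⁻ TG TH s∈
      ... | inj₁ s∈TG = x∈p∪q⁺ (inj₁ (x∈p∧x∉q⇒x∈p─q s∈TG (x∉p∪q⇒x∉q s∉)))
      ... | inj₂ s∈TH = x∈p∪q⁺ (inj₂ s∈TH)

      edge : ∀ {x y} → E ((G ⊕ H) - (Y ∪ ⁅ v ⁆)) x y → E (((G - ⁅ v ⁆) ⊕ H) - Y) x y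
      edge (inj₁ e , x∉ , y∉) =
        inj₁ (e , x∉p∪q⇒x∉q x∉ , x∉p∪q⇒x∉q y∉) , x∉p∪q⇒x∉p x∉ , x∉p∪q⇒x∉p y∉
      edge (inj₂ e , x∉ , y∉) = inj₂ e , x∉p∪q⇒x∉p x∉ , x∉p∪q⇒x∉p y∉

      vertex : (V G ∪ V H) ─ (Y ∪ ⁅ v ⁆) ⊆ ((V G ─ ⁅ v ⁆) ∪ V H) ─ Y
      vertex {x} x∈ = x∈p∧x∉q⇒x∈p─q x∈G-v∪H (x∉p∪q⇒x∉p x∉)
        where
        x∉ : x ∉ Y ∪ ⁅ v ⁆
        x∉ = x∈p─q⇒x∉q _ (Y ∪ ⁅ v ⁆) x∈
        x∈G-v∪H : x ∈ (V G ─ ⁅ v ⁆) ∪ V H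
        x∈G-v∪H with x∈p∪q⁻ (V G) (V H) (p─q⊆p _ (Y ∪ ⁅ v ⁆) x∈)
        ... | inj₁ x∈G = x∈p∪q⁺ (inj₁ (x∈p∧x∉q⇒x∈p─q x∈G (x∉p∪q⇒x∉q x∉)))
        ... | inj₂ x∈H = x∈p∪q⁺ (inj₂ x∈H)

      sep′ : Separates (G ⊕ H) (TG ∪ TH) (Y ∪ ⁅ v ⁆)
      sep′ s t s∈ t∈ s∉ t∉ s≢t w =
        sep s t (terminal s∈ s∉) (terminal t∈ t∉) (x∉p∪q⇒x∉p s∉) (x∉p∪q⇒x∉p t∉) s≢t
            (embedWalk edge vertex w)

    feasible-─⁅v⁆ : Simple H → v ∉ V H → TH ⊆ V H → ∀ {Y} →
      Feasible (G ⊕ H) (TG ∪ TH) Y → v ∈ Y →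
      Feasible ((G - ⁅ v ⁆) ⊕ H) ((TG ─ ⁅ v ⁆) ∪ TH) (Y ─ ⁅ v ⁆)
    feasible-─⁅v⁆ sH v∉H TH⊆H {Y} (Y⊆ , sep) v∈Y = ⊆V , sep′
      where
      ≢v-in-H : ∀ {x} → x ∈ V H → x ≢ v
      ≢v-in-H x∈H refl = v∉H x∈H

      ∉Y : ∀ {x} → x ∉ Y ─ ⁅ v ⁆ → x ≢ v → x ∉ Y
      ∉Y x∉ x≢v x∈Y = x∉ (x∈p∧x≢y⇒x∈p-y x∈Y x≢v)

      ⊆V : Y ─ ⁅ v ⁆ ⊆ (V G ─ ⁅ v ⁆) ∪ V H
      ⊆V x∈ with x∈p∪q⁻ (V G) (V H) (Y⊆ (p─q⊆p Y ⁅ v ⁆ x∈))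
      ... | inj₁ x∈G = x∈p∪q⁺ (inj₁ (x∈p∧x∉q⇒x∈p─q x∈G (x∈p─q⇒x∉q Y ⁅ v ⁆ x∈)))
      ... | inj₂ x∈H = x∈p∪q⁺ (inj₂ x∈H)

      terminal : ∀ {s} → s ∈ (TG ─ ⁅ v ⁆) ∪ TH → s ∈ TG ∪ TH × s ≢ v
      terminal s∈ with x∈p∪q⁻ (TG ─ ⁅ v ⁆) TH s∈
      ... | inj₁ s∈TG-v = x∈p∪q⁺ (inj₁ (p─q⊆p TG ⁅ v ⁆ s∈TG-v))
                        , x∉⁅y⁆⇒x≢y (x∈p─q⇒x∉q TG ⁅ v ⁆ s∈TG-v)
      ... | inj₂ s∈TH   = x∈p∪q⁺ (inj₂ s∈TH) , ≢v-in-H (TH⊆H s∈TH)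

      edge : ∀ {x y} → E (((G - ⁅ v ⁆) ⊕ H) - (Y ─ ⁅ v ⁆)) x y → x ≢ v →
             y ≢ v × E ((G ⊕ H) - Y) x y
      edge (inj₁ (e , _ , y∉⁅v⁆) , x∉ , y∉) x≢v =
        let y≢v = x∉⁅y⁆⇒x≢y y∉⁅v⁆ in y≢v , inj₁ e , ∉Y x∉ x≢v , ∉Y y∉ y≢v
      edge (inj₂ e , x∉ , y∉) x≢v =
        let y≢v = ≢v-in-H (proj₂ (Simple.E-V sH e)) in y≢v , inj₂ e , ∉Y x∉ x≢v , ∉Y y∉ y≢v

      vertex : ∀ {x} → x ∈ ((V G ─ ⁅ v ⁆) ∪ V H) ─ (Y ─ ⁅ v ⁆) → x ≢ v →
               x ∈ (V G ∪ V H) ─ Y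
      vertex {x} x∈ x≢v = x∈p∧x∉q⇒x∈p─q x∈G∪H (∉Y (x∈p─q⇒x∉q _ (Y ─ ⁅ v ⁆) x∈) x≢v)
        where
        x∈G∪H : x ∈ V G ∪ V H
        x∈G∪H with x∈p∪q⁻ (V G ─ ⁅ v ⁆) (V H) (p─q⊆p _ (Y ─ ⁅ v ⁆) x∈)
        ... | inj₁ x∈G-v = x∈p∪q⁺ (inj₁ (p─q⊆p (V G) ⁅ v ⁆ x∈G-v))
        ... | inj₂ x∈H   = x∈p∪q⁺ (inj₂ x∈H)

      sep′ : Separates ((G - ⁅ v ⁆) ⊕ H) ((TG ─ ⁅ v ⁆) ∪ TH) (Y ─ ⁅ v ⁆)
      sep′ s t s∈ t∈ s∉ t∉ s≢t w =
        let (s∈T , s≢v) = terminal s∈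
            (t∈T , t≢v) = terminal t∈
        in sep s t s∈T t∈T (∉Y s∉ s≢v) (∉Y t∉ t≢v) s≢t
               (proj₁ (mapWalk (_≢ v) edge vertex s≢v w))

  module _ {G H : Graph n} {B TG TH : Subset n}
           (sG : Simple G) (sH : Simple H) (B⊆G : B ⊆ V G) (H∩G≡B : V H ∩ V G ≡ B)
           (TH⊆H : TH ⊆ V H) where

    in-B : ∀ {x} → x ∈ V H → x ∈ V G → x ∈ B
    in-B = ∈-boundary {G = G} {H} H∩G≡B

    walk-from-inside : ∀ {X} → B ⊆ X → ∀ {s t} → s ∈ V G →
      Walk ((G ⊕ H) - X) s t → Walk (G - X) s t × t ∈ V G
    walk-from-inside {X} B⊆X = mapWalk (_∈ V G) edge vertex
      where
      edge : ∀ {x y} → E ((G ⊕ H) - X) x y → x ∈ V G → y ∈ V G × E (G - X) x y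
      edge (inj₁ e , x∉ , y∉) _   = proj₂ (Simple.E-V sG e) , e , x∉ , y∉
      edge (inj₂ e , x∉ , _) x∈G = ⊥-elim (x∉ (B⊆X (in-B (proj₁ (Simple.E-V sH e)) x∈G)))

      vertex : ∀ {x} → x ∈ (V G ∪ V H) ─ X → x ∈ V G → x ∈ V G ─ X
      vertex x∈ x∈G = x∈p∧x∉q⇒x∈p─q x∈G (x∈p─q⇒x∉q _ X x∈)

    walk-from-outside : ∀ {X} → B ⊆ X → ∀ {s t} → s ∉ V G →
      Walk ((G ⊕ H) - X) s t → Walk ((G ⊕ H) - (X ∪ V G)) s t × t ∉ V G
    walk-from-outside {X} B⊆X = mapWalk (_∉ V G) edge vertex
      where
      ∉X∪G : ∀ {x} → x ∉ X → x ∉ V G → x ∉ X ∪ V G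
      ∉X∪G x∉X x∉G x∈ with x∈p∪q⁻ X (V G) x∈
      ... | inj₁ x∈X = x∉X x∈X
      ... | inj₂ x∈G = x∉G x∈G

      edge : ∀ {x y} → E ((G ⊕ H) - X) x y → x ∉ V G →
             y ∉ V G × E ((G ⊕ H) - (X ∪ V G)) x y
      edge (inj₁ e , _ , _) x∉G = ⊥-elim (x∉G (proj₁ (Simple.E-V sG e)))
      edge (inj₂ e , x∉ , y∉) x∉G = y∉G , inj₂ e , ∉X∪G x∉ x∉G , ∉X∪G y∉ y∉G
        where
        y∉G : _ ∉ V G
        y∉G y∈G = y∉ (B⊆X (in-B (proj₂ (Simple.E-V sH e)) y∈G))

      vertex : ∀ {x} → x ∈ (V G ∪ V H) ─ X → x ∉ V G → x ∈ (V G ∪ V H) ─ (X ∪ V G)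
      vertex x∈ x∉G = x∈p∧x∉q⇒x∈p─q (p─q⊆p _ X x∈) (∉X∪G (x∈p─q⇒x∉q _ X x∈) x∉G)

    feasible-replace-inside : ∀ {Y S} →
      Feasible (G ⊕ H) (TG ∪ TH) Y → Feasible G TG S →
      Feasible (G ⊕ H) (TG ∪ TH) ((Y ─ V G) ∪ (B ∪ S))
    feasible-replace-inside {Y} {S} (Y⊆ , sepY) (S⊆ , sepS) = ⊆V , sepZ
      where
      Z : Subset n
      Z = (Y ─ V G) ∪ (B ∪ S)

      B⊆Z : B ⊆ Z
      B⊆Z x∈B = x∈p∪q⁺ (inj₂ (x∈p∪q⁺ (inj₁ x∈B)))

      S⊆Z : S ⊆ Z
      S⊆Z x∈S = x∈p∪q⁺ (inj₂ (x∈p∪q⁺ (inj₂ x∈S)))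

      ∉Y : ∀ {x} → x ∉ Z → x ∉ V G → x ∉ Y
      ∉Y x∉Z x∉G x∈Y = x∉Z (x∈p∪q⁺ (inj₁ (x∈p∧x∉q⇒x∈p─q x∈Y x∉G)))

      Y⊆Z∪G : Y ⊆ Z ∪ V G
      Y⊆Z∪G {x} x∈Y with x ∈? V G
      ... | yes x∈G = x∈p∪q⁺ (inj₂ x∈G)
      ... | no  x∉G = x∈p∪q⁺ (inj₁ (x∈p∪q⁺ (inj₁ (x∈p∧x∉q⇒x∈p─q x∈Y x∉G))))

      ⊆V : Z ⊆ V G ∪ V H
      ⊆V x∈ with x∈p∪q⁻ (Y ─ V G) (B ∪ S) x∈
      ... | inj₁ x∈Y-G = Y⊆ (p─q⊆p Y (V G) x∈Y-G)
      ... | inj₂ x∈B∪S with x∈p∪q⁻ B S x∈B∪S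
      ...   | inj₁ x∈B = x∈p∪q⁺ (inj₁ (B⊆G x∈B))
      ...   | inj₂ x∈S = x∈p∪q⁺ (inj₁ (S⊆ x∈S))

      terminal-inside : ∀ {s} → s ∈ TG ∪ TH → s ∈ V G → s ∉ Z → s ∈ TG
      terminal-inside s∈ s∈G s∉ with x∈p∪q⁻ TG TH s∈
      ... | inj₁ s∈TG = s∈TG
      ... | inj₂ s∈TH = ⊥-elim (s∉ (B⊆Z (in-B (TH⊆H s∈TH) s∈G)))

      sepZ : Separates (G ⊕ H) (TG ∪ TH) Z
      sepZ s t s∈ t∈ s∉ t∉ s≢t w with s ∈? V G
      ... | yes s∈G =
        let (w′ , t∈G) = walk-from-inside B⊆Z s∈G w
        in sepS s t (terminal-inside s∈ s∈G s∉) (terminal-inside t∈ t∈G t∉)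
                (s∉ ∘ S⊆Z) (t∉ ∘ S⊆Z) s≢t (walk-─-⊆ S⊆Z w′)
      ... | no s∉G =
        let (w′ , t∉G) = walk-from-outside B⊆Z s∉G w
        in sepY s t s∈ t∈ (∉Y s∉ s∉G) (∉Y t∉ t∉G) s≢t (walk-─-⊆ Y⊆Z∪G w′)

    cheaper-than-centre-avoiding : ∀ {ℓ S v Y} → Feasible G TG S → ∣ S ∣ ≤ ℓ →
      FanPaths G TG v (ℓ + ∣ B ∣ + 2) →
      Feasible (G ⊕ H) (TG ∪ TH) Y → v ∉ Y →
      ∃[ Z ] (Feasible (G ⊕ H) (TG ∪ TH) Z × ∣ Z ∣ < ∣ Y ∣)
    cheaper-than-centre-avoiding {ℓ} {S} {v} {Y} S-feas ∣S∣≤ℓ fan Y-feas v∉Y =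
      _ , feasible-replace-inside Y-feas S-feas , ∣Z∣<∣Y∣
      where
      open ≤-Reasoning
      a b c : ℕ
      a = ∣ Y ─ V G ∣
      b = ∣ B ∣
      c = ∣ Y ∩ V G ∣

      b+ℓ<c : b + ℓ < c
      b+ℓ<c = subst (_< c) (+-comm ℓ b)
        (s≤s⁻¹ (subst (_≤ suc c) (+-comm (ℓ + b) 2)
          (fan-meets sG (separates-⊕ˡ (proj₂ Y-feas)) v∉Y fan)))

      ∣Z∣<∣Y∣ : ∣ (Y ─ V G) ∪ (B ∪ S) ∣ < ∣ Y ∣
      ∣Z∣<∣Y∣ = begin-strict
        ∣ (Y ─ V G) ∪ (B ∪ S) ∣ ≤⟨ ∣p∪q∣≤∣p∣+∣q∣ (Y ─ V G) (B ∪ S) ⟩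
        a + ∣ B ∪ S ∣           ≤⟨ +-monoʳ-≤ a (∣p∪q∣≤∣p∣+∣q∣ B S) ⟩
        a + (b + ∣ S ∣)         ≤⟨ +-monoʳ-≤ a (+-monoʳ-≤ b ∣S∣≤ℓ) ⟩
        a + (b + ℓ)             <⟨ +-monoʳ-< a b+ℓ<c ⟩
        a + c                   ≡⟨ ∣p─q∣+∣p∩q∣≡∣p∣ Y (V G) ⟩
        ∣ Y ∣                   ∎

lemma16 : {n : ℕ} (G : Graph n) (B TG : Subset n) (ℓ : ℕ) →
    Simple G → B ⊆ V G → TG ⊆ V G →
    (∃[ S ] (Feasible G TG S × ∣ S ∣ ≤ ℓ)) →
    (v : Fin n) → v ∈ (V G ─ B) →
    FanPaths G TG v (ℓ + ∣ B ∣ + 2) →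
    (H : Graph n) (TH : Subset n) →
    Simple H → V H ∩ V G ≡ B → TH ⊆ V H →
    (k k′ : ℕ) →
    IsOPT (G ⊕ H) (TG ∪ TH) k →
    IsOPT ((G - ⁅ v ⁆) ⊕ H) ((TG ─ ⁅ v ⁆) ∪ TH) k′ →
    k ≡ suc k′
lemma16 G B TG ℓ sG B⊆G _ (S , S-feas , ∣S∣≤ℓ) v v∈G─B fan H TH sH H∩G≡B TH⊆H k k′
        ((Y , Y-feas , ∣Y∣≡k) , k-min) ((Y′ , Y′-feas , ∣Y′∣≡k′) , k′-min) =
  ≤-antisym k≤1+k′ 1+k′≤k
  where
  open ≤-Reasoning

  v∈G : v ∈ V G
  v∈G = p─q⊆p (V G) B v∈G─B

  v∉H : v ∉ V H
  v∉H v∈H = x∈p─q⇒x∉q (V G) B v∈G─B (∈-boundary {G = G} {H} H∩G≡B v∈H v∈G)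

  k≤1+k′ : k ≤ suc k′
  k≤1+k′ = begin
    k                   ≤⟨ k-min _ (feasible-∪⁅v⁆ v∈G Y′-feas) ⟩
    ∣ Y′ ∪ ⁅ v ⁆ ∣      ≤⟨ ∣p∪q∣≤∣p∣+∣q∣ Y′ ⁅ v ⁆ ⟩
    ∣ Y′ ∣ + ∣ ⁅ v ⁆ ∣  ≡⟨ cong₂ _+_ ∣Y′∣≡k′ (∣⁅x⁆∣≡1 v) ⟩
    k′ + 1              ≡⟨ +-comm k′ 1 ⟩
    suc k′              ∎

  v∈Y : v ∈ Y
  v∈Y = decidable-stable (v ∈? Y) λ v∉Y →
    let (Z , Z-feas , ∣Z∣<∣Y∣) = cheaper-than-centre-avoiding sG sH B⊆G H∩G≡B TH⊆H
                                   S-feas ∣S∣≤ℓ fan Y-feas v∉Y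
    in <⇒≱ ∣Z∣<∣Y∣ (subst (_≤ ∣ Z ∣) (sym ∣Y∣≡k) (k-min Z Z-feas))

  1+k′≤k : suc k′ ≤ k
  1+k′≤k = begin
    suc k′             ≤⟨ s≤s (k′-min _ (feasible-─⁅v⁆ sH v∉H TH⊆H Y-feas v∈Y)) ⟩
    suc ∣ Y ─ ⁅ v ⁆ ∣  ≤⟨ x∈p⇒∣p-x∣<∣p∣ v∈Y ⟩
    ∣ Y ∣              ≡⟨ ∣Y∣≡k ⟩
    k                  ∎
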